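{- Let $(G=(V,E),L,c,r,e_r)$ be a rooted WRAP instance and $\vec F\subseteq\mathrm{Shadows}(L)$ a non-shortenable directed WRAP solution. Then: (1) for every $v\in V$, the set of descendants of $v$ in $(V,\vec F)$ is an interval; (2) for all $v_1,v_2\in V$, the least common ancestor of $v_1$ and $v_2$ in $(V,\vec F)$ lies between $v_1$ and $v_2$.
   Context: Rooted WRAP instance: cycle $G=(V,E)$, links $L\subseteq\binom V2$, costs $c$, root $r$, edge $e_r\in E$ at $r$. $\mathcal C_G=\{C\subseteq V\setminus\{r\}:|\delta_E(C)|=2\}$. Directed link $(u,v)$ covers $C$ if $v\in C,u\notin C$; directed WRAP solution covers all $C\in\mathcal C_G$. Shortening of $(u,v)$: $(s,v)$, $s\ne v$, $s$ on the $u$-$v$ path of $(V,E\setminus\{e_r\})$ (strict if $s\ne u$); shadows of $\{u,v\}$: shortenings of $(u,v)$ or $(v,u)$. Non-shortenable: deleting or strictly shortening any link destroys feasibility; such $\vec F$ makes $(V,\vec F)$ an $r$-arborescence (descendants of $v$ include $v$). Number $V=\{r=v_0,\dots,v_{n-1}\}$ along the path $(V,E\setminus\{e_r\})$ from $r$; an interval is a set $\{v_i,v_{i+1},\dots,v_j\}$. A vertex $s$ lies between $u$ and $w$ if it lies on the unique $u$-$w$ path in $(V,E\setminus\{e_r\})$ (endpoints included). -}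

module Defs where

open import Data.Nat using (ℕ; zero; suc; _≤_; _<?_)
open import Data.Fin using (Fin; toℕ; fromℕ<; _≟_)
import Data.Fin as F
open import Data.Bool using (Bool; true; false; _xor_; if_then_else_; _∧_; not)
open import Data.List using (List; allFin; map)
open import Data.Nat.ListAction using (sum)
open import Data.List.Membership.Propositional using (_∈_)
open import Data.Product using (Σ; ∃; _×_; _,_)
open import Data.Sum using (_⊎_)
open import Relation.Nullary using (¬_; yes; no; does)
open import Relation.Binary.PropositionalEquality using (_≡_; _≢_)

-- Vertices of the cycle G are Fin n, numbered v_0 = r, v_1, ..., v_{n-1}
-- along the path (V, E \ {e_r}).  The edges of G are {v_i, v_{i+1}}
-- (0 ≤ i < n-1) together with e_r = {v_{n-1}, v_0}; i.e. the edge with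
-- index i is {i, next i}.

next : ∀ {n} → Fin n → Fin n
next {suc n} i with suc (toℕ i) <? suc n
... | yes p = fromℕ< p
... | no _  = F.zero

VSet : ℕ → Set
VSet n = Fin n → Bool

cutSize : ∀ {n} → VSet n → ℕ
cutSize {n} C = sum (map (λ i → if C i xor C (next i) then 1 else 0) (allFin n))

InCG : ∀ {n} → Fin n → VSet n → Set
InCG r C = (C r ≡ false) × (cutSize C ≡ 2)

Between : ∀ {n} → Fin n → Fin n → Fin n → Set
Between s u w = (toℕ u ≤ toℕ s × toℕ s ≤ toℕ w) ⊎ (toℕ w ≤ toℕ s × toℕ s ≤ toℕ u)

DLinks : ℕ → Set
DLinks n = Fin n → Fin n → Bool

Covers : ∀ {n} → Fin n → Fin n → VSet n → Set
Covers u v C = (C v ≡ true) × (C u ≡ false)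

Feasible : ∀ {n} → Fin n → DLinks n → Set
Feasible {n} r F = ∀ (C : VSet n) → InCG r C →
  Σ (Fin n) λ u → Σ (Fin n) λ v → (F u v ≡ true) × Covers u v C

-- (links) a link {u,v} is given as a pair (u , v) with u ≢ v
Link : ℕ → Set
Link n = Fin n × Fin n

IsShortening : ∀ {n} → Fin n → Fin n → Fin n → Fin n → Set
IsShortening s t u v = (t ≡ v) × (s ≢ v) × Between s u v

IsShadow : ∀ {n} → List (Link n) → Fin n → Fin n → Set
IsShadow L s t = ∃ λ uv → (uv ∈ L) × Shd uv
  where
  Shd : _ → Set
  Shd (u , v) = IsShortening s t u v ⊎ IsShortening s t v u

remove : ∀ {n} → DLinks n → Fin n → Fin n → DLinks n
remove F u v a b = F a b ∧ not (does (a ≟ u) ∧ does (b ≟ v))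

replace : ∀ {n} → DLinks n → Fin n → Fin n → Fin n → DLinks n
replace F u v s a b = remove F u v a b Data.Bool.∨ (does (a ≟ s) ∧ does (b ≟ v))

NonShortenable : ∀ {n} → Fin n → DLinks n → Set
NonShortenable {n} r F =
  Feasible r F ×
  (∀ u v → F u v ≡ true → ¬ Feasible r (remove F u v)) ×
  (∀ u v s → F u v ≡ true → s ≢ u → IsShortening s v u v →
     ¬ Feasible r (replace F u v s))

data Desc {n} (F : DLinks n) : Fin n → Fin n → Set where
  here : ∀ {v} → Desc F v v
  step : ∀ {v u w} → F v u ≡ true → Desc F u w → Desc F v w

IsInterval : ∀ {n} → (Fin n → Set) → Set
IsInterval {n} D = Σ (Fin n) λ i → Σ (Fin n) λ j → ∀ w →
  (D w → toℕ i ≤ toℕ w × toℕ w ≤ toℕ j) × (toℕ i ≤ toℕ w × toℕ w ≤ toℕ j → D w)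

IsLCA : ∀ {n} → DLinks n → Fin n → Fin n → Fin n → Set
IsLCA {n} F a v₁ v₂ = Desc F a v₁ × Desc F a v₂ ×
  (∀ b → Desc F b v₁ → Desc F b v₂ → Desc F b a)

module Submission where

open import Defs
open import Data.Nat using (ℕ; zero; suc; _+_; _∸_; _≤_; _<_; _≤?_; _<?_; _⊓_; _⊔_; s≤s; z≤n)
import Data.Nat as ℕ
open import Data.Nat.Properties hiding (_≟_)
open import Data.Nat.Induction using (Acc; acc; <-wellFounded)
open import Data.Nat.ListAction using (sum)
open import Data.Bool using (Bool; true; false; not; _xor_; _∨_; if_then_else_)
import Data.Bool as Bool
open import Data.Bool.Properties using (¬-not; ∨-zeroʳ; xor-assoc; xor-same; xor-comm; true-xor; xor-identityʳ)
open import Data.Fin using (Fin; toℕ; fromℕ<; inject₁) renaming (zero to fzero; suc to fsuc)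
import Data.Fin.Properties as Fin
open import Data.Fin.Properties using (_≟_)
open import Data.List using (List; tabulate)
open import Data.List.Properties using (map-tabulate)
open import Data.List.Relation.Unary.All using (All)
open import Data.Product using (∃; ∃₂; _×_; _,_; proj₁; proj₂)
open import Data.Sum using (_⊎_; inj₁; inj₂)
open import Data.Unit using (⊤; tt)
open import Data.Empty using (⊥)
open import Function using (_∘_; id; _⇔_; mk⇔; Equivalence)
open import Relation.Nullary using (¬_; Dec; yes; no; does; contradiction)
open import Relation.Nullary.Decidable
  using (dec-true; dec-false; _×-dec_; _⊎-dec_; _→-dec_; ¬?; decidable-stable; map′)
open import Relation.Unary using (Pred; Decidable)
open import Relation.Binary using (tri<; tri≈; tri>)
open import Relation.Binary.PropositionalEquality
  using (_≡_; _≢_; refl; sym; trans; cong; cong₂; subst; module ≡-Reasoning)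

-- The sets of 𝒞_G are the intervals [i, j] with 1 ≤ i ≤ j < n: walking once around the cycle, a set
-- with cut size two changes membership exactly twice. So feasibility says that every such interval is
-- entered by a link, and non-shortenability gives each link (x, y) a witness: an interval containing y,
-- entered by no other link and bordering x, namely an interval left uncovered when (x, y) is shortened
-- by one step. Take for W(x, y) a maximal witness. For a child link (y, z) the hull of W(x, y) and
-- W(y, z) is again entered only by (x, y), hence a witness, so W(y, z) ⊆ W(x, y) by maximality. Thus the
-- descendants of y lie in W(x, y); conversely, walking up the links from a vertex of W(x, y) never leaves
-- W(x, y) before reaching y, and it terminates since witnesses strictly grow upwards. So the descendants
-- of y form the interval W(x, y). Finally, if the least common ancestor a of v₁ and v₂ were not between
-- them, both would lie on one side of a; the witnesses of the links from a towards them border a on that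
-- side, so they are nested and the child with the larger one is a common ancestor below a.

dec-true⁻¹ : ∀ {a} {A : Set a} (a? : Dec A) → does a? ≡ true → A
dec-true⁻¹ (yes a) _ = a

least : ∀ {p} {P : Pred ℕ p} → Decidable P → ∀ {k} → P k →
        ∃ λ l → P l × (∀ {m} → P m → l ≤ m)
least {P = P} P? {k} = go k (<-wellFounded k)
  where
  go : ∀ k → Acc _<_ k → P k → ∃ λ l → P l × (∀ {m} → P m → l ≤ m)
  go k (acc rs) pk with anyUpTo? P? k
  ... | yes (m , m<k , pm) = go m (rs m<k) pm
  ... | no none            = k , pk , λ {m} pm → ≮⇒≥ (λ m<k → none (m , m<k , pm))

-- Intervals of natural numbers

record Interval : Set where
  constructor [_,_]
  field lo hi : ℕ
open Interval public

infix 4 _∈ᵢ_ _∉ᵢ_ _∈ᵢ?_ _⊆ᵢ_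

_∈ᵢ_ : ℕ → Interval → Set
k ∈ᵢ I = lo I ≤ k × k ≤ hi I

_∉ᵢ_ : ℕ → Interval → Set
k ∉ᵢ I = ¬ k ∈ᵢ I

_∈ᵢ?_ : ∀ k I → Dec (k ∈ᵢ I)
k ∈ᵢ? I = (lo I ≤? k) ×-dec (k ≤? hi I)

_⊆ᵢ_ : Interval → Interval → Set
I ⊆ᵢ J = ∀ {k} → k ∈ᵢ I → k ∈ᵢ J

∉ᵢ⇒outside : ∀ {k I} → k ∉ᵢ I → k < lo I ⊎ hi I < k
∉ᵢ⇒outside {k} {I} k∉I with lo I ≤? k
... | no lo≰k = inj₁ (≰⇒> lo≰k)
... | yes lo≤k = inj₂ (≰⇒> (λ k≤hi → k∉I (lo≤k , k≤hi)))

weight : ℕ → Interval → ℕ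
weight n I = lo I + (n ∸ hi I)

weight-< : ∀ {n I J k} → hi J < n → lo I ≤ hi I → I ⊆ᵢ J → k ∈ᵢ J → k ∉ᵢ I →
           weight n J < weight n I
weight-< {n} {I} {J} {k} hiJ<n lo≤hi I⊆J k∈J k∉I with ∉ᵢ⇒outside {k} {I} k∉I
... | inj₁ k<lo = +-mono-<-≤ (≤-<-trans (proj₁ k∈J) k<lo) (∸-monoʳ-≤ n (proj₂ (I⊆J (lo≤hi , ≤-refl))))
... | inj₂ hi<k = +-mono-≤-< (proj₁ (I⊆J (≤-refl , lo≤hi)))
                            (∸-monoʳ-< (<-≤-trans hi<k (proj₂ k∈J)) (<⇒≤ hiJ<n))

hull : Interval → Interval → Interval
hull I J = [ lo I ⊓ lo J , hi I ⊔ hi J ]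

⊆ᵢ-by-bounds : ∀ {I J} → lo J ≤ lo I → hi I ≤ hi J → I ⊆ᵢ J
⊆ᵢ-by-bounds loJ≤loI hiI≤hiJ (lo≤k , k≤hi) = ≤-trans loJ≤loI lo≤k , ≤-trans k≤hi hiI≤hiJ

⊆-hullˡ : ∀ {I J} → I ⊆ᵢ hull I J
⊆-hullˡ {I} {J} = ⊆ᵢ-by-bounds (m⊓n≤m (lo I) (lo J)) (m≤m⊔n (hi I) (hi J))

⊆-hullʳ : ∀ {I J} → J ⊆ᵢ hull I J
⊆-hullʳ {I} {J} = ⊆ᵢ-by-bounds (m⊓n≤n (lo I) (lo J)) (m≤n⊔m (hi I) (hi J))

hull-split : ∀ {I J k} → lo J ≤ suc (hi I) → lo I ≤ suc (hi J) → k ∈ᵢ hull I J → k ∈ᵢ I ⊎ k ∈ᵢ J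
hull-split {I} {J} {k} loJ≤ loI≤ (⊓≤k , k≤⊔) with k ∈ᵢ? I
... | yes k∈I = inj₁ k∈I
... | no k∉I with ∉ᵢ⇒outside {k} {I} k∉I
...   | inj₁ k<loI = inj₂ (lower , ≤-pred (<-≤-trans k<loI loI≤))
  where
  lower : lo J ≤ k
  lower with ⊓-sel (lo I) (lo J)
  ... | inj₁ eq = contradiction (subst (_≤ k) eq ⊓≤k) (<⇒≱ k<loI)
  ... | inj₂ eq = subst (_≤ k) eq ⊓≤k
...   | inj₂ hiI<k = inj₂ (≤-trans loJ≤ hiI<k , upper)
  where
  upper : k ≤ hi J
  upper with ⊔-sel (hi I) (hi J)
  ... | inj₁ eq = contradiction (subst (k ≤_) eq k≤⊔) (<⇒≱ hiI<k)
  ... | inj₂ eq = subst (k ≤_) eq k≤⊔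

Neighbours : ℕ → ℕ → Set
Neighbours k s = suc k ≡ s ⊎ suc s ≡ k

Adjacent : ℕ → Interval → Set
Adjacent k I = lo I ≡ suc k ⊎ suc (hi I) ≡ k

adjacent-by-neighbour : ∀ {k s I} → Neighbours k s → s ∈ᵢ I → k ∉ᵢ I → Adjacent k I
adjacent-by-neighbour {k} {I = I} (inj₁ refl) (lo≤s , s≤hi) k∉I with ∉ᵢ⇒outside {k} {I} k∉I
... | inj₁ k<lo = inj₁ (≤-antisym lo≤s k<lo)
... | inj₂ hi<k = contradiction (<-trans hi<k (n<1+n k)) (≤⇒≯ s≤hi)
adjacent-by-neighbour {I = I} (inj₂ refl) (lo≤s , s≤hi) k∉I with ∉ᵢ⇒outside {_} {I} k∉I
... | inj₁ k<lo = contradiction (<-trans (n<1+n _) k<lo) (≤⇒≯ lo≤s)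
... | inj₂ hi<k = inj₂ (cong suc (≤-antisym (≤-pred hi<k) s≤hi))

neighbour-in : ∀ {k I} → Adjacent k I → lo I ≤ hi I → ∃ λ s → Neighbours k s × s ∈ᵢ I
neighbour-in {I = I} (inj₁ eq) lo≤hi = lo I , inj₁ (sym eq) , ≤-refl , lo≤hi
neighbour-in {I = I} (inj₂ eq) lo≤hi = hi I , inj₂ eq , lo≤hi , ≤-refl

touching : ∀ {k I J} → Adjacent k J → lo J ≤ hi J → k ∈ᵢ I → lo J ≤ suc (hi I) × lo I ≤ suc (hi J)
touching (inj₁ refl) loJ≤hiJ (lo≤k , k≤hi) = s≤s k≤hi , ≤-trans lo≤k (≤-trans (n≤1+n _) (m≤n⇒m≤1+n loJ≤hiJ))
touching (inj₂ refl) loJ≤hiJ (lo≤k , k≤hi) = ≤-trans loJ≤hiJ (m≤n⇒m≤1+n (≤-trans (n≤1+n _) k≤hi)) , lo≤k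

adjacent-right : ∀ {k v I} → Adjacent k I → k < v → v ∈ᵢ I → lo I ≡ suc k
adjacent-right (inj₁ eq) _ _ = eq
adjacent-right (inj₂ refl) k<v (_ , v≤hi) = contradiction (<-trans (n<1+n _) k<v) (≤⇒≯ v≤hi)

adjacent-left : ∀ {k v I} → Adjacent k I → v < k → v ∈ᵢ I → suc (hi I) ≡ k
adjacent-left (inj₁ refl) v<k (lo≤v , _) = contradiction (<-trans v<k (n<1+n _)) (≤⇒≯ lo≤v)
adjacent-left (inj₂ eq) _ _ = eq

SameSide : ℕ → ℕ → ℕ → Set
SameSide a v w = (a < v × a < w) ⊎ (v < a × w < a)

SameSide-irreflˡ : ∀ {a w} → ¬ SameSide a a w
SameSide-irreflˡ (inj₁ (a<a , _)) = <-irrefl refl a<a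
SameSide-irreflˡ (inj₂ (a<a , _)) = <-irrefl refl a<a

SameSide-irreflʳ : ∀ {a v} → ¬ SameSide a v a
SameSide-irreflʳ (inj₁ (_ , a<a)) = <-irrefl refl a<a
SameSide-irreflʳ (inj₂ (_ , a<a)) = <-irrefl refl a<a

between-or-same-side : ∀ a v w → ((v ≤ a × a ≤ w) ⊎ (w ≤ a × a ≤ v)) ⊎ SameSide a v w
between-or-same-side a v w with v ≤? a | w ≤? a
... | yes v≤a | no w≰a = inj₁ (inj₁ (v≤a , <⇒≤ (≰⇒> w≰a)))
... | no v≰a | yes w≤a = inj₁ (inj₂ (w≤a , <⇒≤ (≰⇒> v≰a)))
... | no v≰a | no w≰a = inj₂ (inj₁ (≰⇒> v≰a , ≰⇒> w≰a))
... | yes v≤a | yes w≤a with a ≤? w | a ≤? v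
...   | yes a≤w | _ = inj₁ (inj₁ (v≤a , a≤w))
...   | no _ | yes a≤v = inj₁ (inj₂ (w≤a , a≤v))
...   | no a≰w | no a≰v = inj₂ (inj₂ (≰⇒> a≰v , ≰⇒> a≰w))

-- Both intervals end next to a on the side of v and w, so one contains the other.
adjacent-nested : ∀ {a v w I J} → Adjacent a I → Adjacent a J → v ∈ᵢ I → w ∈ᵢ J →
                  SameSide a v w → I ⊆ᵢ J ⊎ J ⊆ᵢ I
adjacent-nested {I = I} {J} adjI adjJ v∈I w∈J (inj₁ (a<v , a<w))
  with adjacent-right adjI a<v v∈I | adjacent-right adjJ a<w w∈J | ≤-total (hi I) (hi J)
... | loI | loJ | inj₁ hiI≤hiJ = inj₁ (⊆ᵢ-by-bounds (≤-reflexive (trans loJ (sym loI))) hiI≤hiJ)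
... | loI | loJ | inj₂ hiJ≤hiI = inj₂ (⊆ᵢ-by-bounds (≤-reflexive (trans loI (sym loJ))) hiJ≤hiI)
adjacent-nested {I = I} {J} adjI adjJ v∈I w∈J (inj₂ (v<a , w<a))
  with adjacent-left adjI v<a v∈I | adjacent-left adjJ w<a w∈J | ≤-total (lo I) (lo J)
... | hiI | hiJ | inj₁ loI≤loJ = inj₂ (⊆ᵢ-by-bounds loI≤loJ (≤-reflexive (suc-injective (trans hiJ (sym hiI)))))
... | hiI | hiJ | inj₂ loJ≤loI = inj₁ (⊆ᵢ-by-bounds loJ≤loI (≤-reflexive (suc-injective (trans hiI (sym hiJ)))))

-- Changes along a Boolean sequence

partialSum : (ℕ → ℕ) → ℕ → ℕ
partialSum g zero    = 0
partialSum g (suc k) = partialSum g k + g k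

partialSum-cons : ∀ g k → partialSum g (suc k) ≡ g 0 + partialSum (g ∘ suc) k
partialSum-cons g zero    = +-comm 0 (g 0)
partialSum-cons g (suc k) = trans (cong (_+ g (suc k)) (partialSum-cons g k)) (+-assoc (g 0) _ _)

sum-tabulate : ∀ {k} (f : Fin k → ℕ) (g : ℕ → ℕ) → (∀ i → f i ≡ g (toℕ i)) →
               sum (tabulate f) ≡ partialSum g k
sum-tabulate {zero}  f g f≗g = refl
sum-tabulate {suc k} f g f≗g = begin
  f fzero + sum (tabulate (f ∘ fsuc))  ≡⟨ cong₂ _+_ (f≗g fzero) (sum-tabulate (f ∘ fsuc) (g ∘ suc) (f≗g ∘ fsuc)) ⟩
  g 0 + partialSum (g ∘ suc) k           ≡⟨ sym (partialSum-cons g k) ⟩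
  partialSum g (suc k)                   ∎
  where open ≡-Reasoning

partialSum-mono : ∀ g {k k'} → k ≤ k' → partialSum g k ≤ partialSum g k'
partialSum-mono g {k} {zero}   z≤n = ≤-refl
partialSum-mono g {k} {suc k'} k≤1+k' with m≤n⇒m<n∨m≡n k≤1+k'
... | inj₂ refl = ≤-refl
... | inj₁ k<1+k' = ≤-trans (partialSum-mono g (≤-pred k<1+k')) (m≤m+n _ _)

partialSum-const : ∀ g {a b} → (∀ {l} → a ≤ l → l < b → g l ≡ 0) → a ≤ b →
                   partialSum g b ≡ partialSum g a
partialSum-const g {a} {zero}  g≡0 z≤n = refl
partialSum-const g {a} {suc b} g≡0 a≤1+b with m≤n⇒m<n∨m≡n a≤1+b
... | inj₂ refl = refl
... | inj₁ a<1+b = begin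
  partialSum g b + g b ≡⟨ cong (partialSum g b +_) (g≡0 (≤-pred a<1+b) ≤-refl) ⟩
  partialSum g b + 0   ≡⟨ +-identityʳ _ ⟩
  partialSum g b       ≡⟨ partialSum-const g (λ a≤l l<b → g≡0 a≤l (m<n⇒m<1+n l<b)) (≤-pred a<1+b) ⟩
  partialSum g a       ∎
  where open ≡-Reasoning

changes : (ℕ → Bool) → ℕ → ℕ
changes c = partialSum λ l → if c l xor c (suc l) then 1 else 0

changes-cong : ∀ {c c'} → (∀ k → c k ≡ c' k) → ∀ k → changes c k ≡ changes c' k
changes-cong c≗c' zero    = refl
changes-cong c≗c' (suc k) =
  cong₂ (λ s b → s + (if b then 1 else 0)) (changes-cong c≗c' k) (cong₂ _xor_ (c≗c' k) (c≗c' (suc k)))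

changes-mono : ∀ c {k k'} → k ≤ k' → changes c k ≤ changes c k'
changes-mono c = partialSum-mono _

changes-step : ∀ c k → changes c (suc k) ≤ suc (changes c k)
changes-step c k with c k xor c (suc k)
... | true  = ≤-reflexive (+-comm _ 1)
... | false = ≤-trans (≤-reflexive (+-identityʳ _)) (n≤1+n _)

changes-const : ∀ c {a b} → (∀ {l} → a ≤ l → l < b → c l ≡ c (suc l)) → a ≤ b →
                changes c b ≡ changes c a
changes-const c c-const = partialSum-const _ λ {l} a≤l l<b →
  cong (λ b → if b then 1 else 0) (trans (cong (_xor c (suc l)) (c-const a≤l l<b)) (xor-same (c (suc l))))

xor-≢ : ∀ {a b} → a ≢ b → a xor b ≡ true
xor-≢ {true}  {true}  a≢b = contradiction refl a≢b
xor-≢ {true}  {false} _   = refl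
xor-≢ {false} {true}  _   = refl
xor-≢ {false} {false} a≢b = contradiction refl a≢b

changes-flip : ∀ c k → c k ≢ c (suc k) → changes c (suc k) ≡ suc (changes c k)
changes-flip c k flip = trans (cong (λ b → changes c k + (if b then 1 else 0)) (xor-≢ flip)) (+-comm _ 1)

odd : ℕ → Bool
odd zero    = false
odd (suc k) = not (odd k)

odd-+-indicator : ∀ k b → odd (k + (if b then 1 else 0)) ≡ odd k xor b
odd-+-indicator k true  = trans (cong odd (+-comm k 1)) (trans (sym (true-xor (odd k))) (xor-comm true (odd k)))
odd-+-indicator k false = trans (cong odd (+-identityʳ k)) (sym (xor-identityʳ (odd k)))

changes-parity : ∀ c → c 0 ≡ false → ∀ k → c k ≡ odd (changes c k)
changes-parity c c0 zero    = c0
changes-parity c c0 (suc k) = sym (begin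
  odd (changes c k + (if c k xor c (suc k) then 1 else 0)) ≡⟨ odd-+-indicator (changes c k) (c k xor c (suc k)) ⟩
  odd (changes c k) xor (c k xor c (suc k))                ≡⟨ cong (_xor (c k xor c (suc k))) (sym (changes-parity c c0 k)) ⟩
  c k xor (c k xor c (suc k))                              ≡⟨ sym (xor-assoc (c k) (c k) (c (suc k))) ⟩
  (c k xor c k) xor c (suc k)                              ≡⟨ cong (_xor c (suc k)) (xor-same (c k)) ⟩
  c (suc k)                                                ∎)
  where open ≡-Reasoning

odd-≤2 : ∀ {x} → x ≤ 2 → odd x ≡ true → x ≡ 1
odd-≤2 {1} _ _ = refl
odd-≤2 {suc (suc (suc _))} (s≤s (s≤s ())) _

threshold : ∀ {t : ℕ → ℕ} → (∀ {k k'} → k ≤ k' → t k ≤ t k') → ∀ {h N} → h ≤ t N →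
            ∃ λ l → ∀ {k} → (h ≤ t k → l ≤ k) × (l ≤ k → h ≤ t k)
threshold {t} mono {h} h≤tN with least (λ k → h ≤? t k) h≤tN
... | l , h≤tl , minimal = l , minimal , λ l≤k → ≤-trans h≤tl (mono l≤k)

indicator : Interval → ℕ → Bool
indicator I k = does (k ∈ᵢ? I)

changes-indicator : ∀ {I N} → 1 ≤ lo I → lo I ≤ hi I → hi I < N → changes (indicator I) N ≡ 2
changes-indicator {[ suc i , j ]} {N} _ 1+i≤j j<N = begin
  changes c N             ≡⟨ changes-const c (λ j<l _ → steady-right j<l) j<N ⟩
  changes c (suc j)       ≡⟨ changes-flip c j (differ (inside 1+i≤j ≤-refl) (right ≤-refl)) ⟩
  suc (changes c j)       ≡⟨ cong suc (changes-const c steady-inside 1+i≤j) ⟩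
  suc (changes c (suc i)) ≡⟨ cong suc (changes-flip c i (differ (inside ≤-refl 1+i≤j) (left ≤-refl) ∘ sym)) ⟩
  suc (suc (changes c i)) ≡⟨ cong (suc ∘ suc) (changes-const c (λ _ l<i → steady-left l<i) z≤n) ⟩
  2                       ∎
  where
  open ≡-Reasoning
  c = indicator [ suc i , j ]
  differ : ∀ {a b : Bool} → a ≡ true → b ≡ false → a ≢ b
  differ refl refl ()
  inside : ∀ {l} → suc i ≤ l → l ≤ j → c l ≡ true
  inside 1+i≤l l≤j = dec-true (_ ∈ᵢ? _) (1+i≤l , l≤j)
  left : ∀ {l} → l ≤ i → c l ≡ false
  left l≤i = dec-false (_ ∈ᵢ? _) λ (1+i≤l , _) → <⇒≱ 1+i≤l l≤i
  right : ∀ {l} → j < l → c l ≡ false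
  right j<l = dec-false (_ ∈ᵢ? _) λ (_ , l≤j) → <⇒≱ j<l l≤j
  steady-left : ∀ {l} → l < i → c l ≡ c (suc l)
  steady-left l<i = trans (left (<⇒≤ l<i)) (sym (left l<i))
  steady-inside : ∀ {l} → suc i ≤ l → l < j → c l ≡ c (suc l)
  steady-inside 1+i≤l l<j = trans (inside 1+i≤l (<⇒≤ l<j)) (sym (inside (m≤n⇒m≤1+n 1+i≤l) l<j))
  steady-right : ∀ {l} → j < l → c l ≡ c (suc l)
  steady-right j<l = trans (right j<l) (sym (right (m<n⇒m<1+n j<l)))

-- The sets of the cycle with cut size two

-- The nonempty intervals of non-root vertices; by interval∈𝒞 and cut⇒interval these are the sets of 𝒞_G.
record Proper (n : ℕ) (I : Interval) : Set where
  constructor proper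
  field
    1≤lo  : 1 ≤ lo I
    lo≤hi : lo I ≤ hi I
    hi<n  : hi I < n

proper? : ∀ n I → Dec (Proper n I)
proper? n I = map′ (λ (p , q , r) → proper p q r) (λ (proper p q r) → p , q , r)
  ((1 ≤? lo I) ×-dec (lo I ≤? hi I) ×-dec (hi I <? n))

module Cycle (m : ℕ) where

  V : Set
  V = Fin (suc m)

  wrap : ℕ → V
  wrap k with k <? suc m
  ... | yes k<n = fromℕ< k<n
  ... | no _    = fzero

  next≡wrap : (i : V) → next i ≡ wrap (suc (toℕ i))
  next≡wrap i with suc (toℕ i) <? suc m
  ... | yes _ = refl
  ... | no _  = refl

  wrap-toℕ : (i : V) → wrap (toℕ i) ≡ i
  wrap-toℕ i with toℕ i <? suc m
  ... | yes i<n = Fin.fromℕ<-toℕ i i<n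
  ... | no i≮n  = contradiction (Fin.toℕ<n i) i≮n

  toℕ-wrap : ∀ {k} → k < suc m → toℕ (wrap k) ≡ k
  toℕ-wrap {k} k<n with k <? suc m
  ... | yes _   = Fin.toℕ-fromℕ< k<n
  ... | no k≮n  = contradiction k<n k≮n

  wrap-beyond : ∀ {k} → ¬ k < suc m → wrap k ≡ fzero
  wrap-beyond {k} k≮n with k <? suc m
  ... | yes k<n = contradiction k<n k≮n
  ... | no _    = refl

  cyclic : VSet (suc m) → ℕ → Bool
  cyclic C k = C (wrap k)

  cutSize≡changes : ∀ C → cutSize C ≡ changes (cyclic C) (suc m)
  cutSize≡changes C = trans (cong sum (map-tabulate id f)) (sum-tabulate f _ f≗)
    where
    f : V → ℕ
    f i = if C i xor C (next i) then 1 else 0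
    f≗ : ∀ i → f i ≡ (if cyclic C (toℕ i) xor cyclic C (suc (toℕ i)) then 1 else 0)
    f≗ i = cong₂ (λ a b → if a xor b then 1 else 0) (cong C (sym (wrap-toℕ i))) (cong C (next≡wrap i))

  intervalSet : Interval → VSet (suc m)
  intervalSet I w = indicator I (toℕ w)

  interval∈𝒞 : ∀ {I} → Proper (suc m) I → InCG fzero (intervalSet I)
  interval∈𝒞 {I} (proper 1≤lo lo≤hi hi<n) = root∉ , (begin
    cutSize (intervalSet I)                 ≡⟨ cutSize≡changes (intervalSet I) ⟩
    changes (cyclic (intervalSet I)) (suc m) ≡⟨ changes-cong cyclic≗indicator (suc m) ⟩
    changes (indicator I) (suc m)           ≡⟨ changes-indicator 1≤lo lo≤hi hi<n ⟩
    2                                       ∎)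
    where
    open ≡-Reasoning
    root∉ : intervalSet I fzero ≡ false
    root∉ = dec-false (0 ∈ᵢ? I) λ (lo≤0 , _) → <⇒≱ 1≤lo lo≤0
    cyclic≗indicator : ∀ k → cyclic (intervalSet I) k ≡ indicator I k
    cyclic≗indicator k with k ≤? m
    ... | yes k≤m = cong (indicator I) (toℕ-wrap (s≤s k≤m))
    ... | no k≰m  = trans (cong (intervalSet I) (wrap-beyond (k≰m ∘ ≤-pred)))
                      (trans root∉ (sym (dec-false (k ∈ᵢ? I) λ (_ , k≤hi) → k≰m (≤-pred (≤-<-trans k≤hi hi<n)))))

  module _ {C : VSet (suc m)} (root∉C : C fzero ≡ false) (cut≡2 : cutSize C ≡ 2) where
    private
      t : ℕ → ℕ
      t = changes (cyclic C)

      t-end : t (suc m) ≡ 2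
      t-end = trans (sym (cutSize≡changes C)) cut≡2

      C≡odd : ∀ w → C w ≡ odd (t (toℕ w))
      C≡odd w = trans (cong C (sym (wrap-toℕ w)))
                  (changes-parity (cyclic C) (trans (cong C (wrap-toℕ fzero)) root∉C) (toℕ w))

      t≤2 : ∀ w → t (toℕ w) ≤ 2
      t≤2 w = subst (t (toℕ w) ≤_) t-end (changes-mono (cyclic C) (<⇒≤ (Fin.toℕ<n w)))

    -- By parity, C holds exactly where one of the two changes of C along the path has occurred.
    cut⇒interval : ∃ λ I → Proper (suc m) I × (∀ w → C w ≡ true ⇔ toℕ w ∈ᵢ I)
    cut⇒interval with threshold (changes-mono (cyclic C)) (≤-trans (s≤s z≤n) (≤-reflexive (sym t-end)))
                    | threshold (changes-mono (cyclic C)) (≤-reflexive (sym t-end))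
    ... | _ | zero , two = contradiction (proj₂ (two {0}) z≤n) λ ()
    ... | i , one | suc j , two = [ i , j ] , proper 1≤i i≤j j<n , λ w → mk⇔ (to w) (from w)
      where
      1≤i : 1 ≤ i
      1≤i = ≰⇒> λ i≤0 → contradiction (proj₂ (one {0}) i≤0) λ ()
      j<n : j < suc m
      j<n = proj₁ two (≤-reflexive (sym t-end))
      i≤j : i ≤ j
      i≤j = proj₁ one (≤-pred (≤-trans (proj₂ two ≤-refl) (changes-step (cyclic C) j)))
      to : ∀ w → C w ≡ true → toℕ w ∈ᵢ [ i , j ]
      to w Cw = proj₁ one (≤-reflexive (sym t≡1)) ,
                ≮⇒≥ λ j<k → contradiction (subst (2 ≤_) t≡1 (proj₂ two j<k)) λ { (s≤s ()) }
        where
        t≡1 : t (toℕ w) ≡ 1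
        t≡1 = odd-≤2 (t≤2 w) (trans (sym (C≡odd w)) Cw)
      from : ∀ w → toℕ w ∈ᵢ [ i , j ] → C w ≡ true
      from w (i≤k , k≤j) = trans (C≡odd w) (cong odd t≡1)
        where
        t≡1 : t (toℕ w) ≡ 1
        t≡1 = ≤-antisym (≮⇒≥ λ 2≤t → <⇒≱ (proj₁ two 2≤t) k≤j) (proj₂ one i≤k)

  Enters : DLinks (suc m) → V → V → Interval → Set
  Enters G a b I = G a b ≡ true × toℕ b ∈ᵢ I × toℕ a ∉ᵢ I

  enters? : ∀ G a b I → Dec (Enters G a b I)
  enters? G a b I = (G a b Bool.≟ true) ×-dec (toℕ b ∈ᵢ? I) ×-dec ¬? (toℕ a ∈ᵢ? I)

  Covered : DLinks (suc m) → Interval → Set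
  Covered G I = ∃₂ λ a b → Enters G a b I

  covered? : ∀ G I → Dec (Covered G I)
  covered? G I = Fin.any? λ a → Fin.any? λ b → enters? G a b I

  IntervalFeasible : DLinks (suc m) → Set
  IntervalFeasible G = ∀ I → Proper (suc m) I → Covered G I

  feasible⇒intervalFeasible : ∀ {G} → Feasible fzero G → IntervalFeasible G
  feasible⇒intervalFeasible feasible I I-proper with feasible (intervalSet I) (interval∈𝒞 I-proper)
  ... | a , b , Gab , b∈ , a∉ = a , b , Gab , dec-true⁻¹ (toℕ b ∈ᵢ? I) b∈ ,
                                 λ a∈ → contradiction (trans (sym a∉) (dec-true (toℕ a ∈ᵢ? I) a∈)) λ ()

  intervalFeasible⇒feasible : ∀ {G} → IntervalFeasible G → Feasible fzero G
  intervalFeasible⇒feasible feasible C (root∉C , cut≡2) with cut⇒interval root∉C cut≡2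
  ... | I , I-proper , C⇔I with feasible I I-proper
  ...   | a , b , Gab , b∈ , a∉ = a , b , Gab , Equivalence.from (C⇔I b) b∈ , ¬-not (a∉ ∘ Equivalence.to (C⇔I a))

  uncovered : ∀ {G} → ¬ IntervalFeasible G → ∃ λ I → Proper (suc m) I × ¬ Covered G I
  uncovered {G} infeasible
    with anyUpTo? (λ l → anyUpTo? (λ h → proper? (suc m) [ l , h ] ×-dec ¬? (covered? G [ l , h ])) (suc m)) (suc m)
  ... | yes (l , _ , h , _ , I-proper , ¬covered) = [ l , h ] , I-proper , ¬covered
  ... | no none = contradiction feasible infeasible
    where
    feasible : IntervalFeasible G
    feasible I I-proper@(proper _ lo≤hi hi<n) = decidable-stable (covered? G I) λ ¬covered →
      none (lo I , ≤-<-trans lo≤hi hi<n , hi I , hi<n , I-proper , ¬covered)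

-- Non-shortenable solutions

Desc-snoc : ∀ {n} {F : DLinks n} {v u w} → Desc F v u → F u w ≡ true → Desc F v w
Desc-snoc here        Fuw = step Fuw here
Desc-snoc (step Fvx d) Fuw = step Fvx (Desc-snoc d Fuw)

module _ {n} {F : DLinks n} {u v : Fin n} where

  remove-keeps : ∀ {a b} → F a b ≡ true → ¬ (a ≡ u × b ≡ v) → remove F u v a b ≡ true
  remove-keeps {a} {b} Fab ab≢uv rewrite Fab with a ≟ u | b ≟ v
  ... | yes refl | yes refl = contradiction (refl , refl) ab≢uv
  ... | yes _    | no _     = refl
  ... | no _     | _        = refl

  replace-keeps : ∀ {s a b} → F a b ≡ true → ¬ (a ≡ u × b ≡ v) → replace F u v s a b ≡ true
  replace-keeps Fab ab≢uv = cong (_∨ _) (remove-keeps Fab ab≢uv)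

  replace-adds : ∀ {s} → replace F u v s s v ≡ true
  replace-adds {s} rewrite dec-true (s ≟ s) refl | dec-true (v ≟ v) refl = ∨-zeroʳ _

-- A loop covers no set, so it could be removed.
loop-free : ∀ {n r} {F : DLinks n} → NonShortenable r F → ∀ {x} → F x x ≡ true → ⊥
loop-free {F = F} (feasible , irremovable , _) {x} Fxx = irremovable x x Fxx feasible′
  where
  feasible′ : Feasible _ (remove F x x)
  feasible′ C C∈ with feasible C C∈
  ... | u , v , Fuv , Cv , Cu = u , v , remove-keeps {F = F} {u = x} {v = x} Fuv not-loop , Cv , Cu
    where
    not-loop : ¬ (u ≡ x × v ≡ x)
    not-loop (refl , refl) = contradiction (trans (sym Cv) Cu) λ ()

successor : ∀ {n} (x : Fin n) → suc (toℕ x) < n → ∃ λ (s : Fin n) → toℕ s ≡ suc (toℕ x)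
successor x 1+x<n = fromℕ< 1+x<n , Fin.toℕ-fromℕ< 1+x<n

predecessor : ∀ {n} (x : Fin (suc n)) → 0 < toℕ x → ∃ λ (s : Fin (suc n)) → suc (toℕ s) ≡ toℕ x
predecessor (fsuc i) _ = inject₁ i , cong suc (Fin.toℕ-inject₁ i)

step-toward : ∀ {n} {x y : Fin (suc n)} → x ≢ y →
              ∃ λ s → s ≢ x × Between s x y × Neighbours (toℕ x) (toℕ s)
step-toward {x = x} {y} x≢y with <-cmp (toℕ x) (toℕ y)
... | tri≈ _ x≡y _ = contradiction (Fin.toℕ-injective x≡y) x≢y
... | tri< x<y _ _ with successor x (≤-<-trans x<y (Fin.toℕ<n y))
...   | s , s≡1+x = s , (λ { refl → 1+n≢n (sym s≡1+x) }) ,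
                    inj₁ (subst (toℕ x ≤_) (sym s≡1+x) (n≤1+n _) , subst (_≤ toℕ y) (sym s≡1+x) x<y) ,
                    inj₁ (sym s≡1+x)
step-toward {x = x} {y} x≢y | tri> _ _ y<x with predecessor x (≤-<-trans z≤n y<x)
...   | s , 1+s≡x = s , (λ { refl → 1+n≢n 1+s≡x }) ,
                    inj₂ (≤-pred (subst (suc (toℕ y) ≤_) (sym 1+s≡x) y<x) , subst (toℕ s ≤_) 1+s≡x (n≤1+n _)) ,
                    inj₂ 1+s≡x

nonzero⇒positive : ∀ {n} {w : Fin (suc n)} → w ≢ fzero → 1 ≤ toℕ w
nonzero⇒positive w≢0 = n≢0⇒n>0 (w≢0 ∘ Fin.toℕ-injective)

interval⇒IsInterval : ∀ {n} {D : Fin n → Set} I → lo I < n → hi I < n →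
  (∀ w → D w → toℕ w ∈ᵢ I) → (∀ w → toℕ w ∈ᵢ I → D w) → IsInterval D
interval⇒IsInterval {D = D} I lo<n hi<n D⊆I I⊆D = fromℕ< lo<n , fromℕ< hi<n , λ w →
  subst (λ J → (D w → toℕ w ∈ᵢ J) × (toℕ w ∈ᵢ J → D w)) (sym endpoints) (D⊆I w , I⊆D w)
  where
  endpoints : [ toℕ (fromℕ< lo<n) , toℕ (fromℕ< hi<n) ] ≡ I
  endpoints = cong₂ [_,_] (Fin.toℕ-fromℕ< lo<n) (Fin.toℕ-fromℕ< hi<n)

module Solution {m : ℕ} (F : DLinks (suc m)) (nonShortenable : NonShortenable fzero F) where

  open Cycle m

  private
    n : ℕ
    n = suc m

  intervalFeasible : IntervalFeasible F
  intervalFeasible = feasible⇒intervalFeasible (proj₁ nonShortenable)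

  parent : ∀ w → 1 ≤ toℕ w → ∃ λ a → F a w ≡ true
  parent w 1≤w with intervalFeasible [ toℕ w , toℕ w ] (proper 1≤w ≤-refl (Fin.toℕ<n w))
  ... | a , b , Fab , (w≤b , b≤w) , _ = a , subst (λ b → F a b ≡ true) (Fin.toℕ-injective (≤-antisym b≤w w≤b)) Fab

  OnlyEntering : V → V → Interval → Set
  OnlyEntering x y I = ∀ a b → Enters F a b I → a ≡ x × b ≡ y

  only-enters : ∀ {x y I} → Proper n I → OnlyEntering x y I → Enters F x y I
  only-enters {I = I} I-proper only with intervalFeasible I I-proper
  ... | a , b , ab↝I with only a b ab↝I
  ...   | refl , refl = ab↝I

  record IsWitness (x y : V) (I : Interval) : Set where
    constructor witness
    field
      isProper : Proper n I
      enters   : Enters F x y I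
      only     : OnlyEntering x y I
      adjacent : Adjacent (toℕ x) I

  isWitness? : ∀ x y I → Dec (IsWitness x y I)
  isWitness? x y I = map′ (λ (p , e , o , a) → witness p e o a) (λ (witness p e o a) → p , e , o , a)
    (proper? n I ×-dec enters? F x y I
      ×-dec Fin.all? (λ a → Fin.all? λ b → enters? F a b I →-dec ((a ≟ x) ×-dec (b ≟ y)))
      ×-dec ((lo I ℕ.≟ suc (toℕ x)) ⊎-dec (suc (hi I) ℕ.≟ toℕ x)))

  -- G is F with (x, y) shortened to (s, y), or deleted if s = y.
  witness-of-obstruction : ∀ {x y s} (G : DLinks n) →
    (∀ {a b} → F a b ≡ true → ¬ (a ≡ x × b ≡ y) → G a b ≡ true) → (s ≢ y → G s y ≡ true) →
    Neighbours (toℕ x) (toℕ s) → ¬ IntervalFeasible G → ∃ (IsWitness x y)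
  witness-of-obstruction {x} {y} {s} G keeps adds x~s infeasible with uncovered infeasible
  ... | I , I-proper , ¬covered = I , witness I-proper enters only (adjacent-by-neighbour x~s s∈I (proj₂ (proj₂ enters)))
    where
    only : OnlyEntering x y I
    only a b ab↝I = decidable-stable ((a ≟ x) ×-dec (b ≟ y)) λ ab≢xy →
      ¬covered (a , b , keeps (proj₁ ab↝I) ab≢xy , proj₂ ab↝I)
    enters : Enters F x y I
    enters = only-enters I-proper only
    s∈I : toℕ s ∈ᵢ I
    s∈I with s ≟ y
    ... | yes refl = proj₁ (proj₂ enters)
    ... | no s≢y = decidable-stable (toℕ s ∈ᵢ? I) λ s∉I →
      ¬covered (s , y , adds s≢y , proj₁ (proj₂ enters) , s∉I)

  witness-exists : ∀ {x y} → F x y ≡ true → ∃ (IsWitness x y)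
  witness-exists {x} {y} Fxy with step-toward {x = x} {y} (λ { refl → loop-free nonShortenable Fxy })
  ... | s , s≢x , s-between , x~s with s ≟ y
  ...   | yes refl = witness-of-obstruction (remove F x y) (remove-keeps {F = F}) (λ s≢s → contradiction refl s≢s) x~s
                       (proj₁ (proj₂ nonShortenable) x y Fxy ∘ intervalFeasible⇒feasible)
  ...   | no s≢y   = witness-of-obstruction (replace F x y s) (replace-keeps {F = F}) (λ _ → replace-adds {F = F}) x~s
                       (proj₂ (proj₂ nonShortenable) x y s Fxy s≢x (refl , s≢y , s-between) ∘ intervalFeasible⇒feasible)

  HasWitnessOfWeight : V → V → ℕ → Set
  HasWitnessOfWeight x y k = ∃ λ l → l < n × ∃ λ h → h < n × IsWitness x y [ l , h ] × weight n [ l , h ] ≡ k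

  hasWitnessOfWeight? : ∀ x y k → Dec (HasWitnessOfWeight x y k)
  hasWitnessOfWeight? x y k =
    anyUpTo? (λ l → anyUpTo? (λ h → isWitness? x y [ l , h ] ×-dec (weight n [ l , h ] ℕ.≟ k)) n) n

  witness-weight : ∀ {x y J} → IsWitness x y J → HasWitnessOfWeight x y (weight n J)
  witness-weight {J = J} w@(witness (proper _ lo≤hi hi<n) _ _ _) = lo J , ≤-<-trans lo≤hi hi<n , hi J , hi<n , w , refl

  -- Minimal weight lo + (n ∸ hi): no witness of (x, y) strictly contains this one.
  record MaximalWitness (x y : V) : Set where
    field
      interval  : Interval
      isWitness : IsWitness x y interval
      maximal   : ∀ {J} → IsWitness x y J → weight n interval ≤ weight n J

  abstract
    maximalWitness : ∀ {x y} → F x y ≡ true → MaximalWitness x y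
    maximalWitness {x} {y} Fxy with least (hasWitnessOfWeight? x y) (witness-weight (proj₂ (witness-exists Fxy)))
    ... | _ , (l , _ , h , _ , w , refl) , minimal = record
      { interval = [ l , h ] ; isWitness = w ; maximal = minimal ∘ witness-weight }

  W : ∀ {x y} → F x y ≡ true → Interval
  W Fxy = MaximalWitness.interval (maximalWitness Fxy)

  W-witness : ∀ {x y} (Fxy : F x y ≡ true) → IsWitness x y (W Fxy)
  W-witness Fxy = MaximalWitness.isWitness (maximalWitness Fxy)

  W-maximal : ∀ {x y J} (Fxy : F x y ≡ true) → IsWitness x y J → weight n (W Fxy) ≤ weight n J
  W-maximal Fxy = MaximalWitness.maximal (maximalWitness Fxy)

  W-proper : ∀ {x y} (Fxy : F x y ≡ true) → Proper n (W Fxy)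
  W-proper Fxy = IsWitness.isProper (W-witness Fxy)

  W-head : ∀ {x y} (Fxy : F x y ≡ true) → toℕ y ∈ᵢ W Fxy
  W-head Fxy = proj₁ (proj₂ (IsWitness.enters (W-witness Fxy)))

  W-tail : ∀ {x y} (Fxy : F x y ≡ true) → toℕ x ∉ᵢ W Fxy
  W-tail Fxy = proj₂ (proj₂ (IsWitness.enters (W-witness Fxy)))

  -- The hull of the two witnesses is entered only by (x, y); maximality forces it to be W Fxy.
  W-nested : ∀ {x y z} (Fxy : F x y ≡ true) (Fyz : F y z ≡ true) → W Fyz ⊆ᵢ W Fxy
  W-nested {x} Fxy Fyz {k} k∈Wyz = decidable-stable (k ∈ᵢ? W Fxy) λ k∉Wxy →
    <⇒≱ (weight-< (Proper.hi<n proper-U) lo≤hi ⊆-hullˡ (⊆-hullʳ k∈Wyz) k∉Wxy) (W-maximal Fxy U-witness)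
    where
    open IsWitness (W-witness Fxy)
    open Proper isProper
    open IsWitness (W-witness Fyz) using () renaming (isProper to proper′; only to only′; adjacent to adjacent′)
    U : Interval
    U = hull (W Fxy) (W Fyz)
    touch : lo (W Fyz) ≤ suc (hi (W Fxy)) × lo (W Fxy) ≤ suc (hi (W Fyz))
    touch = touching adjacent′ (Proper.lo≤hi proper′) (W-head Fxy)
    proper-U : Proper n U
    proper-U = proper (⊓-glb 1≤lo (Proper.1≤lo proper′))
                      (≤-trans (m⊓n≤m _ _) (≤-trans lo≤hi (m≤m⊔n _ _)))
                      (⊔-pres-<m hi<n (Proper.hi<n proper′))
    only-U : OnlyEntering x _ U
    only-U a b (Fab , b∈U , a∉U) with hull-split (proj₁ touch) (proj₂ touch) b∈U
    ... | inj₁ b∈Wxy = only a b (Fab , b∈Wxy , a∉U ∘ ⊆-hullˡ)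
    ... | inj₂ b∈Wyz with only′ a b (Fab , b∈Wyz , a∉U ∘ ⊆-hullʳ)
    ...   | refl , refl = contradiction (⊆-hullˡ (W-head Fxy)) a∉U
    enters-U : Enters F x _ U
    enters-U = only-enters proper-U only-U
    U-witness : IsWitness x _ U
    U-witness with neighbour-in adjacent lo≤hi
    ... | s , x~s , s∈Wxy =
      witness proper-U enters-U only-U (adjacent-by-neighbour x~s (⊆-hullˡ s∈Wxy) (proj₂ (proj₂ enters-U)))

  W-shrinks : ∀ {b a w} (Fba : F b a ≡ true) (Faw : F a w ≡ true) → weight n (W Fba) < weight n (W Faw)
  W-shrinks Fba Faw = weight-< (Proper.hi<n (W-proper Fba)) (Proper.lo≤hi (W-proper Faw))
                                (W-nested Fba Faw) (W-head Fba) (W-tail Faw)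

  desc⇒W : ∀ {x y w} (Fxy : F x y ≡ true) → Desc F y w → toℕ w ∈ᵢ W Fxy
  desc⇒W Fxy here         = W-head Fxy
  desc⇒W Fxy (step Fyu d) = W-nested Fxy Fyu (desc⇒W Fyu d)

  climb : (S : V → Set) (t : V) → (∀ {a u} → F a u ≡ true → S u → u ≢ t → S a) →
          (∀ {u} → S u → u ≢ t → 1 ≤ toℕ u) → ∀ {u} → S u → Desc F t u
  climb S t closed nonroot {u} u∈S with u ≟ t
  ... | yes refl = here
  ... | no u≢t = go (proj₂ (parent u (nonroot u∈S u≢t))) (<-wellFounded _) u∈S u≢t
    where
    go : ∀ {a u} (Fau : F a u ≡ true) → Acc _<_ (weight n (W Fau)) → S u → u ≢ t → Desc F t u
    go {a} Fau (acc smaller) u∈S u≢t = Desc-snoc to-a Fau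
      where
      a∈S : S a
      a∈S = closed Fau u∈S u≢t
      to-a : Desc F t a
      to-a with a ≟ t
      ... | yes refl = here
      ... | no a≢t with parent a (nonroot a∈S a≢t)
      ...   | _ , Fba = go Fba (smaller (W-shrinks Fba Fau)) a∈S a≢t

  W⇒desc : ∀ {x y w} (Fxy : F x y ≡ true) → toℕ w ∈ᵢ W Fxy → Desc F y w
  W⇒desc {y = y} Fxy = climb (λ u → toℕ u ∈ᵢ W Fxy) y closed nonroot
    where
    closed : ∀ {a u} → F a u ≡ true → toℕ u ∈ᵢ W Fxy → u ≢ y → toℕ a ∈ᵢ W Fxy
    closed {a} {u} Fau u∈W u≢y = decidable-stable (toℕ a ∈ᵢ? W Fxy) λ a∉W →
      u≢y (proj₂ (IsWitness.only (W-witness Fxy) a u (Fau , u∈W , a∉W)))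
    nonroot : ∀ {u} → toℕ u ∈ᵢ W Fxy → u ≢ y → 1 ≤ toℕ u
    nonroot (lo≤u , _) _ = ≤-trans (Proper.1≤lo (W-proper Fxy)) lo≤u

  root-ancestor : ∀ w → Desc F fzero w
  root-ancestor w = climb (λ _ → ⊤) fzero (λ _ _ _ → tt) (λ _ → nonzero⇒positive) tt

  descendants-interval : ∀ v → IsInterval (Desc F v)
  descendants-interval v with v ≟ fzero
  ... | yes refl = interval⇒IsInterval [ 0 , m ] (s≤s z≤n) ≤-refl
                     (λ w _ → z≤n , ≤-pred (Fin.toℕ<n w)) (λ w _ → root-ancestor w)
  ... | no v≢0 with parent v (nonzero⇒positive v≢0)
  ...   | _ , Fxv = interval⇒IsInterval (W Fxv) (≤-<-trans lo≤hi hi<n) hi<n (λ _ → desc⇒W Fxv) (λ _ → W⇒desc Fxv)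
    where open Proper (W-proper Fxv)

  child-not-ancestor : ∀ {a c} → F a c ≡ true → ¬ Desc F c a
  child-not-ancestor Fac c↝a = W-tail Fac (desc⇒W Fac c↝a)

  common-child : ∀ {a v₁ v₂} → Desc F a v₁ → Desc F a v₂ → SameSide (toℕ a) (toℕ v₁) (toℕ v₂) →
                 ∃ λ c → F a c ≡ true × Desc F c v₁ × Desc F c v₂
  common-child here _ side = contradiction side SameSide-irreflˡ
  common-child _ here side = contradiction side SameSide-irreflʳ
  common-child (step Fac₁ d₁) (step Fac₂ d₂) side
    with adjacent-nested (IsWitness.adjacent (W-witness Fac₁)) (IsWitness.adjacent (W-witness Fac₂))
                         (desc⇒W Fac₁ d₁) (desc⇒W Fac₂ d₂) side
  ... | inj₁ W₁⊆W₂ = _ , Fac₂ , W⇒desc Fac₂ (W₁⊆W₂ (desc⇒W Fac₁ d₁)) , d₂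
  ... | inj₂ W₂⊆W₁ = _ , Fac₁ , d₁ , W⇒desc Fac₁ (W₂⊆W₁ (desc⇒W Fac₂ d₂))

  lca-between : ∀ v₁ v₂ a → IsLCA F a v₁ v₂ → Between a v₁ v₂
  lca-between v₁ v₂ a (a↝v₁ , a↝v₂ , lowest) with between-or-same-side (toℕ a) (toℕ v₁) (toℕ v₂)
  ... | inj₁ between = between
  ... | inj₂ side with common-child a↝v₁ a↝v₂ side
  ...   | c , Fac , c↝v₁ , c↝v₂ = contradiction (lowest c c↝v₁ c↝v₂) (child-not-ancestor Fac)

lemma24 : (n : ℕ) → 3 ≤ n → (r : Fin n) → toℕ r ≡ 0 →
    (L : List (Link n)) → All (λ uv → proj₁ uv ≢ proj₂ uv) L →
    (F : DLinks n) → (∀ s t → F s t ≡ true → IsShadow L s t) →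
    NonShortenable r F →
    (∀ v → IsInterval (λ w → Desc F v w)) ×
    (∀ v₁ v₂ a → IsLCA F a v₁ v₂ → Between a v₁ v₂)
-- Non-shortenability alone already excludes loops.
lemma24 (suc m) _ r r≡0 _ _ F _ nonShortenable = descendants-interval , lca-between
  where
  open Solution F (subst (λ r → NonShortenable r F) (Fin.toℕ-injective {j = fzero} r≡0) nonShortenable)
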